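{- Let $S\subseteq\mathcal{S}_d$, a partition $G_1,\dots,G_g$ of $[d]$, $\bar{\alpha},\bar{\beta}\in[0,1]^g$ and $k\in[d]$ be given. Let $\tau$ be an $(\bar{\alpha},\bar{\beta})$-$k$-fair top-$k$ ranking that minimizes $2\sum_{\pi\in S}\sum_{i\in D_\tau}(\pi(i)-\tau(i))\cdot\mathbb{1}_{\tau(i)<\pi(i)}$ among all $(\bar{\alpha},\bar{\beta})$-$k$-fair top-$k$ rankings, and let $\sigma\in\mathcal{S}_d$ be a ranking that minimizes $2\sum_{\pi\in S}\sum_{i\in[d]}(\pi(i)-\sigma(i))\cdot\mathbb{1}_{\sigma(i)<\pi(i)}$ among all rankings in $\mathcal{S}_d$ with $\sigma(a)=\tau(a)$ for all $a\in D_\tau$. Let $\sigma^*$ be any $(\bar{\alpha},\bar{\beta})$-$k$-fair ranking in $\mathcal{S}_d$ minimizing $\mathrm{Obj}(S,\cdot)$, let $\mathrm{OPT}=\mathrm{Obj}(S,\sigma^*)$, and let $L^*\subseteq[d]$ be the set of candidates in positions $1,\dots,k$ of $\sigma^*$. Then $$\mathrm{Obj}(S,\sigma)\le 2\sum_{\pi\in S}\sum_{i\in L^*}(\pi(i)-\sigma^*(i))\cdot\mathbb{1}_{\sigma^*(i)<\pi(i)}+\mathrm{OPT}.$$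
   Context: $\mathcal{S}_d$ is the set of rankings (permutations) of $[d]$; $\pi(a)$ is the rank of $a$. A top-$k$ ranking is a bijection $\tau:D_\tau\to[k]$ with $D_\tau\subseteq[d]$. A (top-$k$ or full) ranking is $(\bar{\alpha},\bar{\beta})$-$k$-fair if for every group $G_i$ the candidates in its positions $1,\dots,k$ contain at least $\lfloor\alpha_i k\rfloor$ and at most $\lceil\beta_i k\rceil$ members of $G_i$. For full rankings, $F(\pi,\sigma)=\sum_{i\in[d]}|\pi(i)-\sigma(i)|$ and $\mathrm{Obj}(S,\sigma)=\sum_{\pi\in S}F(\pi,\sigma)$. $\mathbb{1}_E$ is the indicator of $E$.
   Formalization: The fairness parameters $\bar{\alpha},\bar{\beta}$ have rational entries in $[0,1]$ instead of real ones. -}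

module Defs where

open import Data.Bool using (Bool; true; false; _∧_; if_then_else_)
open import Data.Nat using (ℕ; zero; suc; _+_; _*_; _∸_; _<_; ∣_-_∣)
open import Data.Nat.Properties using (_<?_)
open import Data.Fin using (Fin; toℕ)
import Data.Fin as Fin
open import Data.Fin.Permutation using (Permutation′; _⟨$⟩ʳ_)
open import Data.List using (List; map)
open import Data.Nat.ListAction using (sum)
open import Data.Integer using (ℤ; +_) renaming (_≤_ to _≤ℤ_)
open import Data.Rational using (ℚ; floor; ceiling; _/_) renaming (_*_ to _*ℚ_)
open import Function.Bundles using (_↣_; Injection)
open import Relation.Nullary using (does)
open import Data.Product using (_×_)

sumF : ∀ {n} → (Fin n → ℕ) → ℕ
sumF {zero} f = 0
sumF {suc n} f = f Fin.zero + sumF (λ i → f (Fin.suc i))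

countF : ∀ {n} → (Fin n → Bool) → ℕ
countF {zero} p = 0
countF {suc n} p = (if p Fin.zero then 1 else 0) + countF (λ i → p (Fin.suc i))

Ranking : ℕ → Set
Ranking d = Permutation′ d

rank : ∀ {d} → Ranking d → Fin d → ℕ
rank π a = suc (toℕ (π ⟨$⟩ʳ a))

-- A top-k ranking τ : D_τ → [k] (bijection, D_τ ⊆ [d]) is represented by its
-- inverse, an injection [k] → [d] sending position p to the candidate at p.
-- D_τ is the image; the candidate cand τ p has rank τ(cand τ p) = p+1.
TopK : ℕ → ℕ → Set
TopK d k = Fin k ↣ Fin d

cand : ∀ {d k} → TopK d k → Fin k → Fin d
cand τ = Injection.to τ

kℚ : ℕ → ℚ
kℚ k = (+ k) / 1

inWindow : ∀ {g} → (Fin g → ℚ) → (Fin g → ℚ) → ℕ → Fin g → ℕ → Set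
inWindow α β k j c = (floor (α j *ℚ kℚ k) ≤ℤ + c) × (+ c ≤ℤ ceiling (β j *ℚ kℚ k))

-- (α,β)-k-fair top-k ranking; groups given by grp : [d] → [g] (G_j = grp⁻¹ j)
FairTopK : ∀ {d g k} → (Fin d → Fin g) → (Fin g → ℚ) → (Fin g → ℚ) → TopK d k → Set
FairTopK {k = k} grp α β τ =
  ∀ j → inWindow α β k j (countF (λ p → does (grp (cand τ p) Fin.≟ j)))

-- (α,β)-k-fair full ranking: positions 1..k are the a with rank π a ≤ k
FairFull : ∀ {d g} → (Fin d → Fin g) → (Fin g → ℚ) → (Fin g → ℚ) → ℕ → Ranking d → Set
FairFull grp α β k π =
  ∀ j → inWindow α β k j (countF (λ a → does (grp a Fin.≟ j) ∧ does (toℕ (π ⟨$⟩ʳ a) <? k)))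

F : ∀ {d} → Ranking d → Ranking d → ℕ
F π σ = sumF (λ i → ∣ rank π i - rank σ i ∣)

Obj : ∀ {d} → List (Ranking d) → Ranking d → ℕ
Obj S σ = sum (map (λ π → F π σ) S)

-- 2 Σ_{π∈S} Σ_{i∈D_τ} (π(i) − τ(i))·1[τ(i)<π(i)]   (truncated subtraction ∸)
costTopK : ∀ {d k} → List (Ranking d) → TopK d k → ℕ
costTopK S τ = 2 * sum (map (λ π → sumF (λ p → rank π (cand τ p) ∸ suc (toℕ p))) S)

costFull : ∀ {d} → List (Ranking d) → Ranking d → ℕ
costFull S σ = 2 * sum (map (λ π → sumF (λ i → rank π i ∸ rank σ i)) S)

costTop : ∀ {d} → List (Ranking d) → ℕ → Ranking d → ℕ
costTop S k σ = 2 * sum (map (λ π → sumF (λ i →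
  if does (toℕ (σ ⟨$⟩ʳ i) <? k) then rank π i ∸ rank σ i else 0)) S)

-- Extend τ to a full ranking ρ by repeatedly swapping the p-th candidate of τ into position p,
-- starting from σ*.  Every swap moves the displaced candidate to a later position, so every
-- candidate ranked beyond k in ρ is ranked no earlier in ρ than in σ*.  Splitting the one-sided
-- cost of ρ at position k therefore bounds it by the top-k cost of τ plus the one-sided cost of
-- σ*.  The former is at most the top-k cost of the fair prefix of σ*, by optimality of τ, and
-- the latter is Obj(S, σ*) because the footrule is twice its one-sided part.  Finally σ is
-- optimal among extensions of τ, so its cost is at most that of ρ.
module Submission where

open import Defs
open import Data.Bool using (Bool; true; false; if_then_else_; _∧_)
open import Data.Nat using (ℕ; zero; suc; _≤_; _<_; _+_; _*_; _∸_; z≤n; s≤s; ∣_-_∣)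
open import Data.Nat.Properties
open import Data.Nat.ListAction using (sum)
open import Data.Fin using (Fin; toℕ; inject≤; fromℕ<) renaming (zero to fz; suc to fs)
open import Data.Fin.Properties using (toℕ-injective; toℕ-inject≤; toℕ-fromℕ<; toℕ<n; inject≤-injective)
  renaming (_≟_ to _≟F_)
open import Data.Fin.Permutation using (Permutation′; _⟨$⟩ʳ_; _⟨$⟩ˡ_; transpose; _∘ₚ_; inverseˡ; inverseʳ; flip)
import Data.Fin.Permutation.Components as PC
open import Data.List using (List; []; _∷_; map)
open import Data.List.Properties using (map-cong)
open import Data.Rational using (ℚ; 0ℚ; 1ℚ) renaming (_≤_ to _≤ℚ_)
open import Data.Product using (_×_; _,_; ∃)
open import Data.Sum using (_⊎_; inj₁; inj₂)
open import Data.Empty using (⊥-elim)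
open import Function.Bundles using (Injection; mk↣)
open import Function.Properties.Inverse using (↔⇒↣)
open import Relation.Nullary using (Dec; does; yes; no; ¬_)
open import Relation.Binary.PropositionalEquality
open import Algebra.Properties.CommutativeSemigroup +-commutativeSemigroup using (interchange)
import Algebra.Properties.CommutativeMonoid.Sum as CommutativeMonoidSum

module ∑ = CommutativeMonoidSum +-0-commutativeMonoid

sumF≡∑ : ∀ {n} (f : Fin n → ℕ) → sumF f ≡ ∑.sum f
sumF≡∑ {zero}  f = refl
sumF≡∑ {suc n} f = cong (f fz +_) (sumF≡∑ (λ i → f (fs i)))

sumF-cong : ∀ {n} {f g : Fin n → ℕ} → (∀ i → f i ≡ g i) → sumF f ≡ sumF g
sumF-cong {zero}  f≗g = refl
sumF-cong {suc n} f≗g = cong₂ _+_ (f≗g fz) (sumF-cong (λ i → f≗g (fs i)))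

sumF-mono-≤ : ∀ {n} {f g : Fin n → ℕ} → (∀ i → f i ≤ g i) → sumF f ≤ sumF g
sumF-mono-≤ {zero}  f≤g = z≤n
sumF-mono-≤ {suc n} f≤g = +-mono-≤ (f≤g fz) (sumF-mono-≤ (λ i → f≤g (fs i)))

sumF-distrib-+ : ∀ {n} (f g : Fin n → ℕ) → sumF (λ i → f i + g i) ≡ sumF f + sumF g
sumF-distrib-+ f g = begin
  sumF (λ i → f i + g i)   ≡⟨ sumF≡∑ (λ i → f i + g i) ⟩
  ∑.sum (λ i → f i + g i)  ≡⟨ ∑.∑-distrib-+ f g ⟩
  ∑.sum f + ∑.sum g        ≡⟨ sym (cong₂ _+_ (sumF≡∑ f) (sumF≡∑ g)) ⟩
  sumF f + sumF g          ∎
  where open ≡-Reasoning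

sumF-permute : ∀ {n} (f : Fin n → ℕ) (π : Permutation′ n) → sumF f ≡ sumF (λ i → f (π ⟨$⟩ʳ i))
sumF-permute f π = begin
  sumF f                      ≡⟨ sumF≡∑ f ⟩
  ∑.sum f                     ≡⟨ ∑.sum-permute f π ⟩
  ∑.sum (λ i → f (π ⟨$⟩ʳ i))  ≡⟨ sym (sumF≡∑ (λ i → f (π ⟨$⟩ʳ i))) ⟩
  sumF (λ i → f (π ⟨$⟩ʳ i))   ∎
  where open ≡-Reasoning

sumF-below : ∀ {d k} (k≤d : k ≤ d) (g : Fin d → ℕ) →
  sumF (λ q → if does (toℕ q <? k) then g q else 0) ≡ sumF (λ p → g (inject≤ p k≤d))
sumF-below {zero}          z≤n       g = refl
sumF-below {suc d} {zero}  z≤n       g = sumF-below {d} z≤n (λ q → g (fs q))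
sumF-below {suc d} {suc k} (s≤s k≤d) g = cong (g fz +_) (sumF-below k≤d (λ q → g (fs q)))

countF≡sumF : ∀ {n} (p : Fin n → Bool) → countF p ≡ sumF (λ i → if p i then 1 else 0)
countF≡sumF {zero}  p = refl
countF≡sumF {suc n} p = cong ((if p fz then 1 else 0) +_) (countF≡sumF (λ i → p (fs i)))

if-split : ∀ (b : Bool) (x : ℕ) → x ≡ (if b then x else 0) + (if b then 0 else x)
if-split true  x = sym (+-identityʳ x)
if-split false x = refl

if-does-then-0-≤ : ∀ {P : Set} (P? : Dec P) {x y : ℕ} → (¬ P → x ≤ y) → (if does P? then 0 else x) ≤ y
if-does-then-0-≤ (yes _) _   = z≤n
if-does-then-0-≤ (no ¬p) x≤y = x≤y ¬p

if-∧ : ∀ (b c : Bool) (x : ℕ) → (if b ∧ c then x else 0) ≡ (if c then (if b then x else 0) else 0)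
if-∧ true  c     x = refl
if-∧ false true  x = refl
if-∧ false false x = refl

sum-map-mono-≤ : ∀ {A : Set} {f g : A → ℕ} → (∀ x → f x ≤ g x) → ∀ xs → sum (map f xs) ≤ sum (map g xs)
sum-map-mono-≤ f≤g []       = z≤n
sum-map-mono-≤ f≤g (x ∷ xs) = +-mono-≤ (f≤g x) (sum-map-mono-≤ f≤g xs)

sum-map-distrib-+ : ∀ {A : Set} (f g : A → ℕ) xs →
  sum (map (λ x → f x + g x) xs) ≡ sum (map f xs) + sum (map g xs)
sum-map-distrib-+ f g []       = refl
sum-map-distrib-+ f g (x ∷ xs) =
  trans (cong (f x + g x +_) (sum-map-distrib-+ f g xs)) (interchange (f x) (g x) _ _)

sum-map-*ˡ : ∀ {A : Set} m (f : A → ℕ) xs → sum (map (λ x → m * f x) xs) ≡ m * sum (map f xs)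
sum-map-*ˡ m f []       = sym (*-zeroʳ m)
sum-map-*ˡ m f (x ∷ xs) = trans (cong (m * f x +_) (sum-map-*ˡ m f xs)) (sym (*-distribˡ-+ m (f x) _))

∣m-n∣≡m∸n+n∸m : ∀ m n → ∣ m - n ∣ ≡ (m ∸ n) + (n ∸ m)
∣m-n∣≡m∸n+n∸m zero    zero    = refl
∣m-n∣≡m∸n+n∸m zero    (suc n) = refl
∣m-n∣≡m∸n+n∸m (suc m) zero    = sym (+-identityʳ (suc m))
∣m-n∣≡m∸n+n∸m (suc m) (suc n) = ∣m-n∣≡m∸n+n∸m m n

m∸n+n≡n∸m+m : ∀ m n → (m ∸ n) + n ≡ (n ∸ m) + m
m∸n+n≡n∸m+m zero    zero    = refl
m∸n+n≡n∸m+m zero    (suc n) = sym (+-identityʳ (suc n))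
m∸n+n≡n∸m+m (suc m) zero    = +-identityʳ (suc m)
m∸n+n≡n∸m+m (suc m) (suc n) = begin
  (m ∸ n) + suc n    ≡⟨ +-suc (m ∸ n) n ⟩
  suc ((m ∸ n) + n)  ≡⟨ cong suc (m∸n+n≡n∸m+m m n) ⟩
  suc ((n ∸ m) + m)  ≡⟨ sym (+-suc (n ∸ m) m) ⟩
  (n ∸ m) + suc m    ∎
  where open ≡-Reasoning

excess : ∀ {d} → Ranking d → Ranking d → ℕ
excess π σ = sumF (λ i → rank π i ∸ rank σ i)

sumF-rank : ∀ {d} (π : Ranking d) → sumF (rank π) ≡ sumF {d} (λ q → suc (toℕ q))
sumF-rank {d} π = sym (sumF-permute (λ (q : Fin d) → suc (toℕ q)) π)

excess-sym : ∀ {d} (π σ : Ranking d) → excess π σ ≡ excess σ π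
excess-sym π σ = +-cancelʳ-≡ (sumF (rank σ)) (excess π σ) (excess σ π) (begin
  excess π σ + sumF (rank σ)                       ≡⟨ sym (sumF-distrib-+ (λ i → rank π i ∸ rank σ i) (rank σ)) ⟩
  sumF (λ i → (rank π i ∸ rank σ i) + rank σ i)    ≡⟨ sumF-cong (λ i → m∸n+n≡n∸m+m (rank π i) (rank σ i)) ⟩
  sumF (λ i → (rank σ i ∸ rank π i) + rank π i)    ≡⟨ sumF-distrib-+ (λ i → rank σ i ∸ rank π i) (rank π) ⟩
  excess σ π + sumF (rank π)                       ≡⟨ cong (excess σ π +_) (trans (sumF-rank π) (sym (sumF-rank σ))) ⟩
  excess σ π + sumF (rank σ)                       ∎)
  where open ≡-Reasoning

F≡2*excess : ∀ {d} (π σ : Ranking d) → F π σ ≡ 2 * excess π σ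
F≡2*excess π σ = begin
  F π σ                    ≡⟨ sumF-cong (λ i → ∣m-n∣≡m∸n+n∸m (rank π i) (rank σ i)) ⟩
  sumF (λ i → (rank π i ∸ rank σ i) + (rank σ i ∸ rank π i))
                           ≡⟨ sumF-distrib-+ (λ i → rank π i ∸ rank σ i) (λ i → rank σ i ∸ rank π i) ⟩
  excess π σ + excess σ π  ≡⟨ cong (excess π σ +_) (sym (excess-sym π σ)) ⟩
  excess π σ + excess π σ  ≡⟨ cong (excess π σ +_) (sym (+-identityʳ (excess π σ))) ⟩
  2 * excess π σ           ∎
  where open ≡-Reasoning

Obj≡costFull : ∀ {d} (S : List (Ranking d)) σ → Obj S σ ≡ costFull S σ
Obj≡costFull S σ =
  trans (cong sum (map-cong (λ π → F≡2*excess π σ) S)) (sum-map-*ˡ 2 (λ π → excess π σ) S)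

topExcess : ∀ {d k} → Ranking d → TopK d k → ℕ
topExcess π τ = sumF (λ p → rank π (cand τ p) ∸ suc (toℕ p))

Extends : ∀ {d k} → Ranking d → TopK d k → Set
Extends ρ τ = ∀ p → toℕ (ρ ⟨$⟩ʳ cand τ p) ≡ toℕ p

DelaysBeyond : ∀ {d} → ℕ → Ranking d → Ranking d → Set
DelaysBeyond p σ ρ = ∀ x → p ≤ toℕ (ρ ⟨$⟩ʳ x) → toℕ (σ ⟨$⟩ʳ x) ≤ toℕ (ρ ⟨$⟩ʳ x)

costTopK-cong : ∀ {d k} (S : List (Ranking d)) (τ τ′ : TopK d k) →
  (∀ p → cand τ p ≡ cand τ′ p) → costTopK S τ ≡ costTopK S τ′
costTopK-cong S τ τ′ τ≗τ′ = cong (λ xs → 2 * sum xs)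
  (map-cong (λ π → sumF-cong (λ p → cong (λ a → rank π a ∸ suc (toℕ p)) (τ≗τ′ p))) S)

module _ {d k} (k≤d : k ≤ d) where

  prefix : Ranking d → TopK d k
  prefix σ = mk↣ {to = λ p → σ ⟨$⟩ˡ inject≤ p k≤d}
    (λ {p} {q} eq → inject≤-injective k≤d k≤d p q (Injection.injective (↔⇒↣ (flip σ)) eq))

  rank-prefix : ∀ σ p → rank σ (cand (prefix σ) p) ≡ suc (toℕ p)
  rank-prefix σ p = cong suc (trans (cong toℕ (inverseʳ σ)) (toℕ-inject≤ p k≤d))

  sumF-prefix : ∀ (σ : Ranking d) (h : Fin d → ℕ) →
    sumF (λ a → if does (toℕ (σ ⟨$⟩ʳ a) <? k) then h a else 0) ≡ sumF (λ p → h (cand (prefix σ) p))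
  sumF-prefix σ h = begin
    sumF (λ a → if does (toℕ (σ ⟨$⟩ʳ a) <? k) then h a else 0)
      ≡⟨ sumF-permute _ (flip σ) ⟩
    sumF (λ q → if does (toℕ (σ ⟨$⟩ʳ (σ ⟨$⟩ˡ q)) <? k) then h (σ ⟨$⟩ˡ q) else 0)
      ≡⟨ sumF-cong (λ q → cong (λ r → if does (toℕ r <? k) then h (σ ⟨$⟩ˡ q) else 0) (inverseʳ σ)) ⟩
    sumF (λ q → if does (toℕ q <? k) then h (σ ⟨$⟩ˡ q) else 0)
      ≡⟨ sumF-below k≤d (λ q → h (σ ⟨$⟩ˡ q)) ⟩
    sumF (λ p → h (cand (prefix σ) p)) ∎
    where open ≡-Reasoning

  costTop≡costTopK-prefix : ∀ (S : List (Ranking d)) σ → costTop S k σ ≡ costTopK S (prefix σ)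
  costTop≡costTopK-prefix S σ = cong (λ xs → 2 * sum xs) (map-cong (λ π →
    trans (sumF-prefix σ (λ i → rank π i ∸ rank σ i))
          (sumF-cong (λ p → cong (rank π (cand (prefix σ) p) ∸_) (rank-prefix σ p)))) S)

  prefix-fair : ∀ {g} (grp : Fin d → Fin g) α β σ →
    FairFull grp α β k σ → FairTopK grp α β (prefix σ)
  prefix-fair grp α β σ fair j = subst (inWindow α β k j) count-prefix (fair j)
    where
    inG : Fin d → Bool
    inG a = does (grp a ≟F j)
    count-prefix : countF (λ a → inG a ∧ does (toℕ (σ ⟨$⟩ʳ a) <? k)) ≡ countF (λ p → inG (cand (prefix σ) p))
    count-prefix = begin
      countF (λ a → inG a ∧ does (toℕ (σ ⟨$⟩ʳ a) <? k))
        ≡⟨ countF≡sumF (λ a → inG a ∧ does (toℕ (σ ⟨$⟩ʳ a) <? k)) ⟩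
      sumF (λ a → if inG a ∧ does (toℕ (σ ⟨$⟩ʳ a) <? k) then 1 else 0)
        ≡⟨ sumF-cong (λ a → if-∧ (inG a) _ 1) ⟩
      sumF (λ a → if does (toℕ (σ ⟨$⟩ʳ a) <? k) then (if inG a then 1 else 0) else 0)
        ≡⟨ sumF-prefix σ (λ a → if inG a then 1 else 0) ⟩
      sumF (λ p → if inG (cand (prefix σ) p) then 1 else 0)
        ≡⟨ sym (countF≡sumF (λ p → inG (cand (prefix σ) p))) ⟩
      countF (λ p → inG (cand (prefix σ) p)) ∎
      where open ≡-Reasoning

  cand-prefix : ∀ ρ (τ : TopK d k) → Extends ρ τ → ∀ p → cand (prefix ρ) p ≡ cand τ p
  cand-prefix ρ τ ρ⊇τ p = begin
    ρ ⟨$⟩ˡ inject≤ p k≤d            ≡⟨ cong (ρ ⟨$⟩ˡ_) (sym ρτp≡p) ⟩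
    ρ ⟨$⟩ˡ (ρ ⟨$⟩ʳ cand τ p)        ≡⟨ inverseˡ ρ ⟩
    cand τ p                       ∎
    where
    open ≡-Reasoning
    ρτp≡p : ρ ⟨$⟩ʳ cand τ p ≡ inject≤ p k≤d
    ρτp≡p = toℕ-injective (trans (ρ⊇τ p) (sym (toℕ-inject≤ p k≤d)))

  excess-≤-topExcess+excess : ∀ σ ρ → DelaysBeyond k σ ρ →
    ∀ π → excess π ρ ≤ topExcess π (prefix ρ) + excess π σ
  excess-≤-topExcess+excess σ ρ ρ≥σ π = begin
    excess π ρ                                  ≡⟨ sumF-cong (λ i → if-split (top i) (f i)) ⟩
    sumF (λ i → (if top i then f i else 0) + (if top i then 0 else f i))
                                                ≡⟨ sumF-distrib-+ (λ i → if top i then f i else 0) _ ⟩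
    sumF (λ i → if top i then f i else 0) + sumF (λ i → if top i then 0 else f i)
                                                ≤⟨ +-mono-≤ (≤-reflexive top-part) (sumF-mono-≤ bottom-part) ⟩
    topExcess π (prefix ρ) + excess π σ     ∎
    where
    open ≤-Reasoning
    top : Fin d → Bool
    top i = does (toℕ (ρ ⟨$⟩ʳ i) <? k)
    f : Fin d → ℕ
    f i = rank π i ∸ rank ρ i
    top-part : sumF (λ i → if top i then f i else 0) ≡ topExcess π (prefix ρ)
    top-part = trans (sumF-prefix ρ f)
      (sumF-cong (λ p → cong (rank π (cand (prefix ρ) p) ∸_) (rank-prefix ρ p)))
    bottom-part : ∀ i → (if top i then 0 else f i) ≤ rank π i ∸ rank σ i
    bottom-part i = if-does-then-0-≤ (toℕ (ρ ⟨$⟩ʳ i) <? k)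
      (λ ρi≮k → ∸-monoʳ-≤ (rank π i) (s≤s (ρ≥σ i (≮⇒≥ ρi≮k))))

  costFull-≤-costTopK+costFull : ∀ (S : List (Ranking d)) σ ρ → DelaysBeyond k σ ρ →
    costFull S ρ ≤ costTopK S (prefix ρ) + costFull S σ
  costFull-≤-costTopK+costFull S σ ρ ρ≥σ = begin
    2 * sum (map (λ π → excess π ρ) S)
      ≤⟨ *-monoʳ-≤ 2 (sum-map-mono-≤ {f = λ π → excess π ρ} (excess-≤-topExcess+excess σ ρ ρ≥σ) S) ⟩
    2 * sum (map (λ π → topExcess π (prefix ρ) + excess π σ) S)
      ≡⟨ cong (2 *_) (sum-map-distrib-+ (λ π → topExcess π (prefix ρ)) (λ π → excess π σ) S) ⟩
    2 * (sum (map (λ π → topExcess π (prefix ρ)) S) + sum (map (λ π → excess π σ) S))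
      ≡⟨ *-distribˡ-+ 2 (sum (map (λ π → topExcess π (prefix ρ)) S)) (sum (map (λ π → excess π σ) S)) ⟩
    costTopK S (prefix ρ) + costFull S σ ∎
    where open ≤-Reasoning

transpose-cases : ∀ {n} (i j v : Fin n) →
  (v ≡ i × PC.transpose i j v ≡ j) ⊎ (v ≡ j × PC.transpose i j v ≡ i) ⊎
  (¬ v ≡ i × ¬ v ≡ j × PC.transpose i j v ≡ v)
transpose-cases i j v with v ≟F i
... | yes v≡i = inj₁ (v≡i , refl)
... | no v≢i with v ≟F j
...   | yes v≡j = inj₂ (inj₁ (v≡j , refl))
...   | no v≢j  = inj₂ (inj₂ (v≢i , v≢j , refl))

module _ {d k} (k≤d : k ≤ d) (τ : TopK d k) (σ : Ranking d) where

  record PartialExtension (p : ℕ) : Set where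
    field
      ρ       : Ranking d
      extends : ∀ q → toℕ q < p → toℕ (ρ ⟨$⟩ʳ cand τ q) ≡ toℕ q
      delays  : DelaysBeyond p σ ρ

  extend-step : ∀ {p} → suc p ≤ k → PartialExtension p → PartialExtension (suc p)
  extend-step {p} p<k ext = record { ρ = ρ ∘ₚ transpose t s ; extends = extends′ ; delays = delays′ }
    where
    open PartialExtension ext
    p̂ : Fin k
    p̂ = fromℕ< p<k
    t : Fin d
    t = fromℕ< (≤-trans p<k k≤d)
    t≡p : toℕ t ≡ p
    t≡p = toℕ-fromℕ< (≤-trans p<k k≤d)
    s : Fin d
    s = ρ ⟨$⟩ʳ cand τ p̂

    p≤s : p ≤ toℕ s
    p≤s = ≮⇒≥ λ s<p →
      let q : Fin k
          q = fromℕ< (<-trans s<p p<k)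
          q≡s : toℕ q ≡ toℕ s
          q≡s = toℕ-fromℕ< (<-trans s<p p<k)
          ρcq≡s : ρ ⟨$⟩ʳ cand τ q ≡ s
          ρcq≡s = toℕ-injective (trans (extends q (subst (_< p) (sym q≡s) s<p)) q≡s)
          q≡p̂ : q ≡ p̂
          q≡p̂ = Injection.injective τ (Injection.injective (↔⇒↣ ρ) ρcq≡s)
      in <-irrefl (trans (sym q≡s) (trans (cong toℕ q≡p̂) (toℕ-fromℕ< p<k))) s<p

    s↦p : toℕ (PC.transpose t s s) ≡ p
    s↦p with transpose-cases t s s
    ... | inj₁ (s≡t , s↦s)          = trans (cong toℕ (trans s↦s s≡t)) t≡p
    ... | inj₂ (inj₁ (_ , s↦t))     = trans (cong toℕ s↦t) t≡p
    ... | inj₂ (inj₂ (_ , s≢s , _)) = ⊥-elim (s≢s refl)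

    extends′ : ∀ q → toℕ q < suc p → toℕ (PC.transpose t s (ρ ⟨$⟩ʳ cand τ q)) ≡ toℕ q
    extends′ q q<1+p with m≤n⇒m<n∨m≡n (≤-pred q<1+p)
    ... | inj₂ q≡p = subst (λ q → toℕ (PC.transpose t s (ρ ⟨$⟩ʳ cand τ q)) ≡ toℕ q)
                      (sym (toℕ-injective (trans q≡p (sym (toℕ-fromℕ< p<k)))))
                      (trans s↦p (sym (toℕ-fromℕ< p<k)))
    ... | inj₁ q<p with transpose-cases t s (ρ ⟨$⟩ʳ cand τ q)
    ...   | inj₁ (ρcq≡t , _)          = ⊥-elim (<-irrefl (trans (sym (extends q q<p)) (trans (cong toℕ ρcq≡t) t≡p)) q<p)
    ...   | inj₂ (inj₁ (ρcq≡s , _))   = ⊥-elim (<⇒≱ q<p (subst (p ≤_) (trans (cong toℕ (sym ρcq≡s)) (extends q q<p)) p≤s))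
    ...   | inj₂ (inj₂ (_ , _ , fixed)) = trans (cong toℕ fixed) (extends q q<p)

    delays′ : DelaysBeyond (suc p) σ (ρ ∘ₚ transpose t s)
    delays′ x p<ρ′x with transpose-cases t s (ρ ⟨$⟩ʳ x)
    ... | inj₁ (ρx≡t , ρ′x≡s) = begin
      toℕ (σ ⟨$⟩ʳ x)                      ≤⟨ delays x (≤-reflexive (sym ρx≡p)) ⟩
      toℕ (ρ ⟨$⟩ʳ x)                      ≡⟨ ρx≡p ⟩
      p                                   ≤⟨ p≤s ⟩
      toℕ s                               ≡⟨ cong toℕ (sym ρ′x≡s) ⟩
      toℕ (PC.transpose t s (ρ ⟨$⟩ʳ x))   ∎
      where
      open ≤-Reasoning
      ρx≡p : toℕ (ρ ⟨$⟩ʳ x) ≡ p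
      ρx≡p = trans (cong toℕ ρx≡t) t≡p
    ... | inj₂ (inj₁ (_ , ρ′x≡t)) = ⊥-elim (n≮n p (subst (p <_) (trans (cong toℕ ρ′x≡t) t≡p) p<ρ′x))
    ... | inj₂ (inj₂ (_ , _ , ρ′x≡ρx)) = subst (λ r → toℕ (σ ⟨$⟩ʳ x) ≤ toℕ r) (sym ρ′x≡ρx)
      (delays x (≤-trans (n≤1+n p) (subst (λ r → suc p ≤ toℕ r) ρ′x≡ρx p<ρ′x)))

  partial-extension : ∀ p → p ≤ k → PartialExtension p
  partial-extension zero    _   = record { ρ = σ ; extends = λ _ () ; delays = λ _ _ → ≤-refl }
  partial-extension (suc p) p<k = extend-step p<k (partial-extension p (<⇒≤ p<k))

  extension : ∃ λ ρ → Extends ρ τ × DelaysBeyond k σ ρ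
  extension = ρ , (λ q → extends q (toℕ<n q)) , delays
    where open PartialExtension (partial-extension k ≤-refl)

lemma4p5 : (d g k : ℕ) (S : List (Ranking d)) (grp : Fin d → Fin g)
    → (∀ j → ∃ λ a → grp a ≡ j)
    → (α β : Fin g → ℚ)
    → (∀ j → (0ℚ ≤ℚ α j) × (α j ≤ℚ 1ℚ))
    → (∀ j → (0ℚ ≤ℚ β j) × (β j ≤ℚ 1ℚ))
    → 1 ≤ k → k ≤ d
    → (τ : TopK d k) → FairTopK grp α β τ
    → (∀ (τ′ : TopK d k) → FairTopK grp α β τ′ → costTopK S τ ≤ costTopK S τ′)
    → (σ : Ranking d) → (∀ p → toℕ (σ ⟨$⟩ʳ cand τ p) ≡ toℕ p)
    → (∀ (σ′ : Ranking d) → (∀ p → toℕ (σ′ ⟨$⟩ʳ cand τ p) ≡ toℕ p)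
         → costFull S σ ≤ costFull S σ′)
    → (σ* : Ranking d) → FairFull grp α β k σ*
    → (∀ (σ′ : Ranking d) → FairFull grp α β k σ′ → Obj S σ* ≤ Obj S σ′)
    → Obj S σ ≤ costTop S k σ* + Obj S σ*
lemma4p5 d g k S grp _ α β _ _ _ k≤d τ _ τ-min σ _ σ-min σ* σ*-fair _ with extension k≤d τ σ*
... | ρ , ρ⊇τ , ρ≥σ* = begin
  Obj S σ                                      ≡⟨ Obj≡costFull S σ ⟩
  costFull S σ                                 ≤⟨ σ-min ρ ρ⊇τ ⟩
  costFull S ρ                                 ≤⟨ costFull-≤-costTopK+costFull k≤d S σ* ρ ρ≥σ* ⟩
  costTopK S (prefix k≤d ρ) + costFull S σ*
    ≡⟨ cong (_+ costFull S σ*) (costTopK-cong S (prefix k≤d ρ) τ (cand-prefix k≤d ρ τ ρ⊇τ)) ⟩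
  costTopK S τ + costFull S σ*
    ≤⟨ +-monoˡ-≤ (costFull S σ*) (τ-min (prefix k≤d σ*) (prefix-fair k≤d grp α β σ* σ*-fair)) ⟩
  costTopK S (prefix k≤d σ*) + costFull S σ*
    ≡⟨ sym (cong₂ _+_ (costTop≡costTopK-prefix k≤d S σ*) (Obj≡costFull S σ*)) ⟩
  costTop S k σ* + Obj S σ*                    ∎
  where open ≤-Reasoning
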